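{- Let $a,b$ be coprime positive integers and $D$ an $a,b$-Dyck path with $\pi(D)=(P,Q)$. There is no $i$ with $1\le i<b-1$ such that $i$ is the maximal element of a block of $Q$ and $i+1$ is the minimal element of a block of $P$.
   Context: An $a,b$-Dyck path is a lattice path from $(0,0)$ to $(b,a)$ with unit north steps $N$ and east steps $E$ staying above the line $y=\frac{a}{b}x$; write it as $D=N^{v_0}EN^{v_1}E\cdots N^{v_{b-1}}E$, $v_i\ge 0$. A vertical run of length $v$ is a $P$-rise if $v>a/b$ and a $Q$-rise if $v<a/b$. For $1\le i\le b-1$ the label $i$ is the point $(i,v_0+\dots+v_{i-1})$. If $v_i>0$, the laser $\ell(i)$ is the segment of slope $a/b$ from label $i$ going northeast until it next meets $D$ (in the interior of an east step). $\ell(D)$ is the set of pairs $(i,j)$ with $\ell(i)$ ending on the east step whose west endpoint has $x$-coordinate $j$. The pair $\pi(D)=(P,Q)$ of set partitions of $[b-1]$: $i,j$ in the same block of $P$ iff labels $i,j$ are not separated by any laser (label $k$ lies strictly below $\ell(k)$); $Q$ is the equivalence relation generated by $i\sim j$ whenever $\ell(i),\ell(j)$ end on the same east step immediately following a $Q$-rise, or $(i,j)\in\ell(D)$, or $(j,i)\in\ell(D)$. (Blocks of $P$ have rank $v_{\min(B)-1}$, blocks of $Q$ rank $v_{\max(B)}$.) -}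

module Defs where

open import Data.Nat using (ℕ; zero; suc; _+_; _*_; _≤_; _<_)
open import Data.Nat.Coprimality using (Coprime)
open import Data.Vec using (Vec; []; _∷_)
open import Data.Product using (_×_; ∃; ∃-syntax)
open import Data.Sum using (_⊎_)
open import Relation.Nullary using (¬_)
open import Relation.Binary.PropositionalEquality using (_≡_)
open import Relation.Binary.Construct.Closure.Equivalence using (EqClosure)

-- A path D = N^{v_0} E N^{v_1} E ... N^{v_{b-1}} E is encoded by its
-- vector of vertical run lengths v = (v_0, ..., v_{b-1}).

run : ∀ {n} → Vec ℕ n → ℕ → ℕ
run []       _       = 0
run (x ∷ xs) zero    = x
run (x ∷ xs) (suc i) = run xs i

-- ht v i = v_0 + ... + v_{i-1}  (height of label i / of east step i-1)
ht : ∀ {n} → Vec ℕ n → ℕ → ℕ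
ht _        zero    = 0
ht []       (suc i) = 0
ht (x ∷ xs) (suc i) = x + ht xs i

-- v encodes an a,b-Dyck path: total height a, and every east step
-- (from (i, ht (i+1)) to (i+1, ht (i+1))) lies weakly above y = a x / b,
-- i.e. a (i+1) ≤ b * ht v (i+1) for 0 ≤ i < b.
IsDyck : (a b : ℕ) → Vec ℕ b → Set
IsDyck a b v = (ht v b ≡ a) × (∀ i → i < b → a * suc i ≤ b * ht v (suc i))

-- The laser from label i (line y = ht v i + (a/b)(x - i)) passes strictly
-- above the east step j (at height ht v (j+1), x ∈ [j, j+1]) at x = j+1:
--   ht v i + a (j+1-i)/b > ht v (j+1)
Crosses : (a b : ℕ) → Vec ℕ b → ℕ → ℕ → Set
Crosses a b v i j = b * ht v (suc j) + a * i < b * ht v i + a * suc j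

-- LaserEnd a b v i e : i is a label (1 ≤ i ≤ b-1) with v_i > 0, and the
-- laser ℓ(i) ends on the east step whose west endpoint has x-coordinate e,
-- i.e. e is the first east step (e ≥ i) at which the laser crosses the path.
-- In other words (i , e) ∈ ℓ(D).
LaserEnd : (a b : ℕ) → Vec ℕ b → ℕ → ℕ → Set
LaserEnd a b v i e =
  (1 ≤ i) × (suc i ≤ b) × (0 < run v i) × (i ≤ e) × (e < b)
  × Crosses a b v i e
  × (∀ j → i ≤ j → j < e → ¬ Crosses a b v i j)

-- Label m lies in the region enclosed by laser ℓ(k) and the path
-- (strictly above the laser): k < m ≤ e where ℓ(k) ends on east step e.
-- (Label k itself lies strictly below ℓ(k).)
Inside : ℕ → ℕ → ℕ → Set
Inside k e m = (k < m) × (m ≤ e)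

-- Labels i and j are not separated by any laser: the P-relation.
SameP : (a b : ℕ) → Vec ℕ b → ℕ → ℕ → Set
SameP a b v i j = ∀ k e → LaserEnd a b v k e →
  (Inside k e i → Inside k e j) × (Inside k e j → Inside k e i)

QGen : (a b : ℕ) → Vec ℕ b → ℕ → ℕ → Set
QGen a b v i j =
  (∃[ e ] (LaserEnd a b v i e × LaserEnd a b v j e × (b * run v e < a)))
  ⊎ LaserEnd a b v i j
  ⊎ LaserEnd a b v j i

SameQ : (a b : ℕ) → Vec ℕ b → ℕ → ℕ → Set
SameQ a b v = EqClosure (QGen a b v)

IsMinP : (a b : ℕ) → Vec ℕ b → ℕ → Set
IsMinP a b v i = ∀ j → 1 ≤ j → j < i → ¬ SameP a b v j i

IsMaxQ : (a b : ℕ) → Vec ℕ b → ℕ → Set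
IsMaxQ a b v i = ∀ j → i < j → j < b → ¬ SameQ a b v i j

-- A laser ℓ(k) ending on east step e encloses exactly the labels k+1, …, e,
-- and lasers cannot cross, so the regions they cut out are nested. If i is
-- maximal in its Q-block then ℓ(i), when it exists, ends on step i itself
-- (it could not reach a later step without linking i to it in Q). If i+1 is
-- minimal in its P-block then no laser ends on step i: the outermost laser
-- ending there starts at a label k that lies in exactly the same regions as
-- i+1. So no laser separates i from i+1, and i+1 is not P-minimal after all.
module Submission where

open import Defs
open import Data.Nat using (ℕ; suc; _+_; _*_; _≤_; _<_; s≤s)
open import Data.Nat.Properties
open import Data.Nat.Induction using (<-wellFounded)
open import Data.Nat.Tactic.RingSolver using (solve-∀)
open import Data.Nat.Coprimality using (Coprime)
open import Data.Vec using (Vec)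
open import Data.Product using (_×_; ∃-syntax; _,_)
open import Data.Sum using (inj₁; inj₂)
open import Data.Empty using (⊥; ⊥-elim)
open import Induction.WellFounded using (Acc; acc)
open import Relation.Binary.Definitions using (tri<; tri≈; tri>)
open import Relation.Nullary using (¬_)
open import Relation.Binary.PropositionalEquality using (_≡_; refl; sym; subst)
open import Relation.Binary.Construct.Closure.Symmetric using (fwd)
import Relation.Binary.Construct.Closure.ReflexiveTransitive as Star

+-cyclic-incompatible : ∀ x y z w h c →
  z + w ≤ x + y → h + y < z + c → x + c ≤ h + w → ⊥
+-cyclic-incompatible x y z w h c z+w≤x+y h+y<z+c x+c≤h+w =
  <-irrefl (sums-equal x y z w h c) (+-mono-≤-< z+w≤x+y (+-mono-<-≤ h+y<z+c x+c≤h+w))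
  where
  sums-equal : ∀ x y z w h c → z + w + (h + y + (x + c)) ≡ x + y + (z + c + (h + w))
  sums-equal = solve-∀

module _ (a b : ℕ) (v : Vec ℕ b) where

  laserEnd-label≥1 : ∀ {k e} → LaserEnd a b v k e → 1 ≤ k
  laserEnd-label≥1 (1≤k , _) = 1≤k

  laserEnd-start≤end : ∀ {k e} → LaserEnd a b v k e → k ≤ e
  laserEnd-start≤end (_ , _ , _ , k≤e , _) = k≤e

  laserEnd-end<b : ∀ {k e} → LaserEnd a b v k e → e < b
  laserEnd-end<b (_ , _ , _ , _ , e<b , _) = e<b

  laserEnd-crosses : ∀ {k e} → LaserEnd a b v k e → Crosses a b v k e
  laserEnd-crosses (_ , _ , _ , _ , _ , crosses , _) = crosses

  laserEnd-first : ∀ {k e} → LaserEnd a b v k e → ∀ j → k ≤ j → j < e → ¬ Crosses a b v k j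
  laserEnd-first (_ , _ , _ , _ , _ , _ , first) = first

  laserEnd-functional : ∀ {k e e′} → LaserEnd a b v k e → LaserEnd a b v k e′ → e ≡ e′
  laserEnd-functional {e = e} {e′} L L′ with <-cmp e e′
  ... | tri< e<e′ _ _ = ⊥-elim (laserEnd-first L′ e (laserEnd-start≤end L) e<e′ (laserEnd-crosses L))
  ... | tri≈ _ e≡e′ _ = e≡e′
  ... | tri> _ _ e′<e = ⊥-elim (laserEnd-first L e′ (laserEnd-start≤end L′) e′<e (laserEnd-crosses L′))

  -- ℓ(p) stays below the path up to step q - 1, ℓ(q) up to step ep, and ℓ(p)
  -- crosses at ep; adding the three inequalities gives a contradiction.
  lasers-nest : ∀ {p ep q eq} → LaserEnd a b v p ep → LaserEnd a b v q eq →
                p < q → q ≤ ep → eq ≤ ep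
  lasers-nest {p} {ep} {suc q} {eq} Lp Lq p<q q≤ep with ≤-<-connex eq ep
  ... | inj₁ eq≤ep = eq≤ep
  ... | inj₂ ep<eq = ⊥-elim (+-cyclic-incompatible
          (b * ht v (suc q)) (a * p) (b * ht v p) (a * suc q) (b * ht v (suc ep)) (a * suc ep)
          (≮⇒≥ (laserEnd-first Lp q (≤-pred p<q) q≤ep))
          (laserEnd-crosses Lp)
          (≮⇒≥ (laserEnd-first Lq ep q≤ep ep<eq)))

  outermost-laser-sameP : ∀ {k e} → LaserEnd a b v k e →
    (∀ k′ → k′ < k → ¬ LaserEnd a b v k′ e) → SameP a b v k (suc e)
  outermost-laser-sameP {k} {e} L outermost k′ e′ L′ = k-inside⇒suc-e-inside , suc-e-inside⇒k-inside
    where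
    k-inside⇒suc-e-inside : Inside k′ e′ k → Inside k′ e′ (suc e)
    k-inside⇒suc-e-inside (k′<k , k≤e′) with m≤n⇒m<n∨m≡n (lasers-nest L′ L k′<k k≤e′)
    ... | inj₁ e<e′ = <-≤-trans k′<k (m≤n⇒m≤1+n (laserEnd-start≤end L)) , e<e′
    ... | inj₂ refl = ⊥-elim (outermost k′ k′<k L′)

    suc-e-inside⇒k-inside : Inside k′ e′ (suc e) → Inside k′ e′ k
    suc-e-inside⇒k-inside (k′<suc-e , e<e′) with <-cmp k′ k
    ... | tri< k′<k _ _ = k′<k , ≤-trans (laserEnd-start≤end L) (<⇒≤ e<e′)
    ... | tri≈ _ refl _ = ⊥-elim (<-irrefl (laserEnd-functional L L′) e<e′)
    ... | tri> _ _ k<k′ = ⊥-elim (<⇒≱ e<e′ (lasers-nest L L′ k<k′ (≤-pred k′<suc-e)))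

  no-laser-ends-before-minP : ∀ {e} → IsMinP a b v (suc e) → ∀ k → ¬ LaserEnd a b v k e
  no-laser-ends-before-minP {e} minP k = go (<-wellFounded k)
    where
    go : ∀ {k} → Acc _<_ k → ¬ LaserEnd a b v k e
    go {k} (acc smaller) L =
      minP k (laserEnd-label≥1 L) (s≤s (laserEnd-start≤end L))
        (outermost-laser-sameP L (λ k′ k′<k → go (smaller k′<k)))

  laser-from-maxQ-ends-at-label : ∀ {i e} → IsMaxQ a b v i → LaserEnd a b v i e → e ≡ i
  laser-from-maxQ-ends-at-label {i} {e} maxQ L with m≤n⇒m<n∨m≡n (laserEnd-start≤end L)
  ... | inj₁ i<e = ⊥-elim (maxQ e i<e (laserEnd-end<b L) (Star.return (fwd (inj₂ (inj₁ L)))))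
  ... | inj₂ i≡e = sym i≡e

  sameP-suc : ∀ {i} → (∀ k → ¬ LaserEnd a b v k i) → (∀ e → ¬ LaserEnd a b v i e) →
              SameP a b v i (suc i)
  sameP-suc {i} noEnd noStart k e L = i-inside⇒suc-i-inside , suc-i-inside⇒i-inside
    where
    i-inside⇒suc-i-inside : Inside k e i → Inside k e (suc i)
    i-inside⇒suc-i-inside (k<i , i≤e) with m≤n⇒m<n∨m≡n i≤e
    ... | inj₁ i<e = m≤n⇒m≤1+n k<i , i<e
    ... | inj₂ refl = ⊥-elim (noEnd k L)

    suc-i-inside⇒i-inside : Inside k e (suc i) → Inside k e i
    suc-i-inside⇒i-inside (k<suc-i , suc-i≤e) with m≤n⇒m<n∨m≡n (≤-pred k<suc-i)
    ... | inj₁ k<i = k<i , ≤-trans (n≤1+n i) suc-i≤e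
    ... | inj₂ refl = ⊥-elim (noStart e L)

proposition3p1 : (a b : ℕ) → 0 < a → 0 < b → Coprime a b →
    (v : Vec ℕ b) → IsDyck a b v →
    ¬ (∃[ i ] ((1 ≤ i) × (suc i < b) × IsMaxQ a b v i × IsMinP a b v (suc i)))
proposition3p1 a b _ _ _ v _ (i , 1≤i , _ , maxQ , minP) =
  minP i 1≤i (n<1+n i) (sameP-suc a b v noEnd noStart)
  where
  noEnd : ∀ k → ¬ LaserEnd a b v k i
  noEnd = no-laser-ends-before-minP a b v minP

  noStart : ∀ e → ¬ LaserEnd a b v i e
  noStart e L = noEnd i (subst (LaserEnd a b v i) (laser-from-maxQ-ends-at-label a b v maxQ L) L)
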